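{- Let $q_1,q_2,q_3,q_4$ be positive integers with $(q_1q_2,q_3q_4)=(q_1,q_2)=(q_3,q_4)=1$, and let $l,m,n$ be integers. Then \begin{align*} \lambda^\ast(q_1q_2,q_3q_4,l,m,n)&=\lambda^\ast\left(q_1,q_3,\,l\,\overline{(q_2q_4)}_{q_1q_3},\,m\,\overline{(q_2q_4)}_{q_1q_3},\,n\,\overline{(q_2q_4)}_{q_1q_3}\right)\\ &\quad\times\lambda^\ast\left(q_2,q_4,\,l\,\overline{(q_1q_3)}_{q_2q_4},\,m\,\overline{(q_1q_3)}_{q_2q_4},\,n\,\overline{(q_1q_3)}_{q_2q_4}\right). \end{align*}
   Context: $e(t)=\exp(2\pi i t)$. For positive integers $q_1,q_2$ and integers $l,m,n$, \[ \lambda^\ast(q_1,q_2,l,m,n)=\sum_{\substack{1\le x,y,z\le q_1q_2\\ x^2+y^2+z+1\equiv 0\ (\mathrm{mod}\ q_1)\\ x^2+y^2+z+2\equiv 0\ (\mathrm{mod}\ q_2)}} e\left(\frac{lx+my+nz}{q_1q_2}\right). \] For integers $a,q$ with $(a,q)=1$, $\overline{a}_q$ denotes an inverse of $a$ modulo $q$. -}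

module Defs where

open import Level using (Level)
open import Data.Nat as ℕ using (ℕ; NonZero)
open import Data.Nat.Properties using (m*n≢0)
open import Data.Nat.Divisibility as ℕD using ()
open import Data.Nat.GCD using (gcd)
open import Data.Integer as ℤ using (ℤ; +_)
open import Data.Integer.Divisibility as ℤD using ()
open import Data.Rational as ℚ using (ℚ)
open import Data.List using (List; []; _∷_; upTo; map)
open import Relation.Nullary using (yes; no)
open import Algebra.Bundles using (CommutativeRing)

range1 : ℕ → List ℕ
range1 N = map ℕ.suc (upTo N)

module _ {c ℓ : Level} (R : CommutativeRing c ℓ) where
  open CommutativeRing R

  -- e is an additive character of ℚ with period 1, i.e. abstractly
  -- t ↦ exp(2πit); ℂ with the genuine exp(2πi·) is an instance.
  record IsExpChar (e : ℚ → Carrier) : Set (c Level.⊔ ℓ) where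
    field
      e-hom : ∀ s t → e (s ℚ.+ t) ≈ e s * e t
      e-one : e ℚ.1ℚ ≈ 1#

  sumR : {A : Set} → List A → (A → Carrier) → Carrier
  sumR []       f = 0#
  sumR (a ∷ as) f = f a + sumR as f

  lamStar : (e : ℚ → Carrier) (q₁ q₂ : ℕ) .{{_ : NonZero q₁}} .{{_ : NonZero q₂}}
            (l m n : ℤ) → Carrier
  lamStar e q₁ q₂ l m n =
    sumR (range1 Q) λ x → sumR (range1 Q) λ y → sumR (range1 Q) λ z →
      term x y z
    where
    Q = q₁ ℕ.* q₂
    instance
      nzQ : NonZero Q
      nzQ = m*n≢0 q₁ q₂
    term : ℕ → ℕ → ℕ → Carrier
    term x y z with q₁ ℕD.∣? (x ℕ.* x ℕ.+ y ℕ.* y ℕ.+ z ℕ.+ 1)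
                  | q₂ ℕD.∣? (x ℕ.* x ℕ.+ y ℕ.* y ℕ.+ z ℕ.+ 2)
    ... | yes _ | yes _ =
      e ((l ℤ.* + x ℤ.+ m ℤ.* + y ℤ.+ n ℤ.* + z) ℚ./ Q)
    ... | _ | _ = 0#

IsInverseMod : ℤ → ℤ → ℕ → Set
IsInverseMod a' a q = (+ q) ℤD.∣ (a' ℤ.* a ℤ.- ℤ.1ℤ)

{-# OPTIONS --safe #-}
-- Put A = q₁q₃ and B = q₂q₄, so that A and B are coprime and AB = q₁q₂q₃q₄.  At every point
-- (x, y, z) the summand of λ*(q₁q₂, q₃q₄) factors: by coprimality the congruences modulo q₁q₂ and
-- q₃q₄ split into those modulo q₁, q₃ and modulo q₂, q₄, and since uB + vA ≡ 1 (mod AB) the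
-- character splits as e(X/AB) = e(Xu/A) e(Xv/B).  The first factor depends only on x, y, z modulo A
-- and the second only modulo B, so by the Chinese remainder theorem (i ↦ (i mod A, i mod B) is a
-- bijection of residues) the triple sum modulo AB is the product of the two triple sums.
module Submission where

open import Defs
open import Level using (Level)
open import Function using (id; _∘_; _⇔_; mk⇔; Equivalence)
open import Function.Definitions using (Injective)
open import Data.Nat as ℕ using (ℕ; zero; suc; NonZero)
open import Data.Nat.Properties using (m*n≢0)
open import Data.Nat.GCD using (gcd)
open import Data.Nat.Coprimality as Coprime using (Coprime)
open import Data.Integer as ℤ using (ℤ; +_)
open import Data.Rational using (ℚ)
open import Data.Product using (_×_; _,_; proj₁; proj₂; ∃)
open import Algebra.Bundles using (CommutativeRing)
open import Relation.Binary.PropositionalEquality as ≡ using (_≡_; _≢_)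

module _ where
  open import Data.Nat using (_+_; _*_; _∸_; _≤_; _<_)
  open import Data.Nat.Properties
    using (*-identityˡ; *-distribʳ-∸; [m+n]∸[m+o]≡n∸o; ≤-antisym; ≤-<-trans; m∸n≤m; m∸n≡0⇒m≤n)
  open import Data.Nat.DivMod using (_%_; _/_; m≡m%n+[m/n]*n; m<n⇒m%n≡m)
  open import Data.Nat.Divisibility
    using (_∣_; divides; ∣-trans; m∣m*n; n∣m*n; m*n∣⇒m∣; m*n∣⇒n∣; n∣m⇒m%n≡0)
  open import Data.Nat.LCM using (lcm; lcm-least; gcd*lcm)
  open Coprime using (coprime-divisor; coprime⇒gcd≡1)
  open ≡ using (refl; sym; trans; cong; cong₂; subst)
  open ≡.≡-Reasoning

  coprime-∣ : ∀ {a b m n} → a ∣ m → b ∣ n → Coprime m n → Coprime a b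
  coprime-∣ a∣m b∣n m⊥n (d∣a , d∣b) = m⊥n (∣-trans d∣a a∣m , ∣-trans d∣b b∣n)

  coprime-*ˡ : ∀ {m n o} → Coprime m o → Coprime n o → Coprime (m * n) o
  coprime-*ˡ {m} m⊥o n⊥o {d} (d∣mn , d∣o) = n⊥o (coprime-divisor d⊥m d∣mn , d∣o)
    where
    d⊥m : Coprime d m
    d⊥m (k∣d , k∣m) = m⊥o (k∣m , ∣-trans k∣d d∣o)

  coprime-*ʳ : ∀ {m n o} → Coprime o m → Coprime o n → Coprime o (m * n)
  coprime-*ʳ o⊥m o⊥n = Coprime.sym (coprime-*ˡ (Coprime.sym o⊥m) (Coprime.sym o⊥n))

  coprime-interchange : ∀ {a b c d} → Coprime a b → Coprime c d → Coprime (a * b) (c * d) →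
                        Coprime (a * c) (b * d)
  coprime-interchange {a} {b} {c} {d} a⊥b c⊥d ab⊥cd =
    coprime-*ˡ (coprime-*ʳ a⊥b a⊥d) (coprime-*ʳ c⊥b c⊥d)
    where
    a⊥d : Coprime a d
    a⊥d = coprime-∣ (m∣m*n b) (n∣m*n c) ab⊥cd
    c⊥b : Coprime c b
    c⊥b = coprime-∣ (m∣m*n d) (n∣m*n a) (Coprime.sym ab⊥cd)

  coprime⇒*∣ : ∀ {m n o} → Coprime m n → m ∣ o → n ∣ o → m * n ∣ o
  coprime⇒*∣ {m} {n} m⊥n m∣o n∣o = subst (_∣ _) lcm≡m*n (lcm-least m∣o n∣o)
    where
    lcm≡m*n : lcm m n ≡ m * n
    lcm≡m*n = begin
      lcm m n           ≡⟨ *-identityˡ (lcm m n) ⟨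
      1 * lcm m n       ≡⟨ cong (_* lcm m n) (coprime⇒gcd≡1 m⊥n) ⟨
      gcd m n * lcm m n ≡⟨ gcd*lcm m n ⟩
      m * n             ∎

  coprime⇒*∣⇔ : ∀ {m n o} → Coprime m n → m * n ∣ o ⇔ (m ∣ o × n ∣ o)
  coprime⇒*∣⇔ {m} {n} m⊥n =
    mk⇔ (λ mn∣o → m*n∣⇒m∣ m n mn∣o , m*n∣⇒n∣ m n mn∣o) (λ (m∣o , n∣o) → coprime⇒*∣ m⊥n m∣o n∣o)

  %≡⇒∣∸ : ∀ {x y} d .{{_ : NonZero d}} → x % d ≡ y % d → d ∣ y ∸ x
  %≡⇒∣∸ {x} {y} d x≡y = divides (y / d ∸ x / d) (begin
    y ∸ x                                     ≡⟨ cong₂ _∸_ (m≡m%n+[m/n]*n y d) (m≡m%n+[m/n]*n x d) ⟩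
    (y % d + y / d * d) ∸ (x % d + x / d * d) ≡⟨ cong (λ r → (y % d + y / d * d) ∸ (r + x / d * d)) x≡y ⟩
    (y % d + y / d * d) ∸ (y % d + x / d * d) ≡⟨ [m+n]∸[m+o]≡n∸o (y % d) (y / d * d) (x / d * d) ⟩
    y / d * d ∸ x / d * d                     ≡⟨ *-distribʳ-∸ d (y / d) (x / d) ⟨
    (y / d ∸ x / d) * d                       ∎)

  crt-injective : ∀ {x y} A B .{{_ : NonZero A}} .{{_ : NonZero B}} → Coprime A B →
                  x < A * B → y < A * B → x % A ≡ y % A → x % B ≡ y % B → x ≡ y
  crt-injective A B A⊥B x<AB y<AB x≡y[A] x≡y[B] =
    ≤-antisym (≥-from x<AB (sym x≡y[A]) (sym x≡y[B])) (≥-from y<AB x≡y[A] x≡y[B])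
    where
    instance
      _ : NonZero (A * B)
      _ = m*n≢0 A B
    ≥-from : ∀ {x y} → y < A * B → x % A ≡ y % A → x % B ≡ y % B → y ≤ x
    ≥-from {x} {y} y<AB ≡A ≡B = m∸n≡0⇒m≤n (begin
      y ∸ x             ≡⟨ m<n⇒m%n≡m (≤-<-trans (m∸n≤m y x) y<AB) ⟨
      (y ∸ x) % (A * B) ≡⟨ n∣m⇒m%n≡0 (y ∸ x) (A * B) (coprime⇒*∣ A⊥B (%≡⇒∣∸ A ≡A) (%≡⇒∣∸ B ≡B)) ⟩
      0                 ∎)

form : ℕ → ℕ → ℕ → ℕ → ℕ
form x y z k = x ℕ.* x ℕ.+ y ℕ.* y ℕ.+ z ℕ.+ k

linear : ℤ → ℤ → ℤ → ℕ → ℕ → ℕ → ℤ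
linear l m n x y z = l ℤ.* + x ℤ.+ m ℤ.* + y ℤ.+ n ℤ.* + z

module _ where
  open import Data.Integer using (_+_; _-_; _*_; -_; 1ℤ)
  open import Data.Integer.Properties using (pos-+; pos-*)
  open import Data.Integer.Divisibility.Signed
    using (_∣_; divides; ∣ᵤ⇒∣; ∣⇒∣ᵤ; ∣-refl; ∣-trans; ∣m∣n⇒∣m+n; ∣m∣n⇒∣m-n; ∣m⇒∣-m; ∣m⇒∣m*n; ∣n⇒∣m*n)
  open import Data.Nat.Divisibility using () renaming (_∣_ to _∣ℕ_)
  open import Data.Integer.Tactic.RingSolver using (solve-∀)
  open import Data.Nat.DivMod using (_%_; _/_; m≡m%n+[m/n]*n)
  open ≡ using (sym; trans; cong; cong₂; subst)
  open ≡.≡-Reasoning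

  ∣m∣m-n⇒∣n : ∀ {d m n} → d ∣ m → d ∣ m - n → d ∣ n
  ∣m∣m-n⇒∣n {d} {m} {n} d∣m d∣m-n = subst (d ∣_) (m-[m-n]≡n m n) (∣m∣n⇒∣m-n d∣m d∣m-n)
    where
    m-[m-n]≡n : ∀ m n → m - (m - n) ≡ n
    m-[m-n]≡n = solve-∀

  ∣m-n⇒∣n-m : ∀ {d m n} → d ∣ m - n → d ∣ n - m
  ∣m-n⇒∣n-m {d} {m} {n} d∣m-n = subst (d ∣_) (-[m-n]≡n-m m n) (∣m⇒∣-m d∣m-n)
    where
    -[m-n]≡n-m : ∀ m n → - (m - n) ≡ n - m
    -[m-n]≡n-m = solve-∀

  coprime⇒*∣ℤ : ∀ {a b i} → Coprime a b → + a ∣ i → + b ∣ i → + (a ℕ.* b) ∣ i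
  coprime⇒*∣ℤ a⊥b a∣i b∣i = ∣ᵤ⇒∣ (coprime⇒*∣ a⊥b (∣⇒∣ᵤ a∣i) (∣⇒∣ᵤ b∣i))

  n∣[1+m]-[1+m%n] : ∀ m n .{{_ : NonZero n}} → + n ∣ + suc m - + suc (m % n)
  n∣[1+m]-[1+m%n] m n = divides (+ (m / n)) (begin
    + suc m - + suc r                         ≡⟨ cong (λ k → + suc k - + suc r) (m≡m%n+[m/n]*n m n) ⟩
    + (suc r ℕ.+ q ℕ.* n) - + suc r           ≡⟨ cong (_- + suc r) (pos-+ (suc r) (q ℕ.* n)) ⟩
    (+ suc r + + (q ℕ.* n)) - + suc r         ≡⟨ cong (λ k → (+ suc r + k) - + suc r) (pos-* q n) ⟩
    (+ suc r + + q * + n) - + suc r           ≡⟨ [r+qn]-r≡qn (+ suc r) (+ q) (+ n) ⟩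
    + q * + n                                 ∎)
    where
    r q : ℕ
    r = m % n
    q = m / n
    [r+qn]-r≡qn : ∀ r q n → (r + q * n) - r ≡ q * n
    [r+qn]-r≡qn = solve-∀

  inverseMod-crt : ∀ {A B u v} → Coprime A B → IsInverseMod u (+ B) A → IsInverseMod v (+ A) B →
                   + (A ℕ.* B) ∣ u * + B + v * + A - 1ℤ
  inverseMod-crt {A} {B} {u} {v} A⊥B u⁻¹ v⁻¹ = coprime⇒*∣ℤ A⊥B
    (subst (+ A ∣_) (rearrange u v (+ A) (+ B)) (∣m∣n⇒∣m+n (∣ᵤ⇒∣ {+ A} {u * + B - 1ℤ} u⁻¹) (∣n⇒∣m*n v ∣-refl)))
    (subst (+ B ∣_) (rearrange′ u v (+ A) (+ B)) (∣m∣n⇒∣m+n (∣ᵤ⇒∣ {+ B} {v * + A - 1ℤ} v⁻¹) (∣n⇒∣m*n u ∣-refl)))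
    where
    rearrange : ∀ u v a b → (u * b - 1ℤ) + v * a ≡ u * b + v * a - 1ℤ
    rearrange = solve-∀
    rearrange′ : ∀ u v a b → (v * a - 1ℤ) + u * b ≡ u * b + v * a - 1ℤ
    rearrange′ = solve-∀

  +form : ∀ x y z k → + form x y z k ≡ + x * + x + + y * + y + + z + + k
  +form x y z k = begin
    + (x ℕ.* x ℕ.+ y ℕ.* y ℕ.+ z ℕ.+ k)         ≡⟨ pos-+ (x ℕ.* x ℕ.+ y ℕ.* y ℕ.+ z) k ⟩
    + (x ℕ.* x ℕ.+ y ℕ.* y ℕ.+ z) + + k         ≡⟨ cong (_+ + k) (pos-+ (x ℕ.* x ℕ.+ y ℕ.* y) z) ⟩
    + (x ℕ.* x ℕ.+ y ℕ.* y) + + z + + k         ≡⟨ cong (λ s → s + + z + + k) (pos-+ (x ℕ.* x) (y ℕ.* y)) ⟩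
    + (x ℕ.* x) + + (y ℕ.* y) + + z + + k       ≡⟨ cong₂ (λ s t → s + t + + z + + k) (pos-* x x) (pos-* y y) ⟩
    + x * + x + + y * + y + + z + + k           ∎

  ∣form⇔∣form : ∀ {D d x y z x′ y′ z′} k → d ∣ℕ D →
                + D ∣ + x - + x′ → + D ∣ + y - + y′ → + D ∣ + z - + z′ →
                d ∣ℕ form x y z k ⇔ d ∣ℕ form x′ y′ z′ k
  ∣form⇔∣form {D} {d} {x} {y} {z} {x′} {y′} {z′} k d∣D Dx Dy Dz = mk⇔
    (λ d∣f  → ∣⇒∣ᵤ {+ d} {f′} (∣m∣m-n⇒∣n (∣ᵤ⇒∣ {+ d} {f} d∣f) d∣f-f′))
    (λ d∣f′ → ∣⇒∣ᵤ {+ d} {f} (∣m∣m-n⇒∣n (∣ᵤ⇒∣ {+ d} {f′} d∣f′) (∣m-n⇒∣n-m {m = f} {n = f′} d∣f-f′)))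
    where
    f f′ : ℤ
    f  = + form x y z k
    f′ = + form x′ y′ z′ k
    restrict : ∀ {i} → + D ∣ i → + d ∣ i
    restrict = ∣-trans (∣ᵤ⇒∣ {+ d} {+ D} d∣D)
    factor : ∀ x y z x′ y′ z′ k →
             (x * x + y * y + z + k) - (x′ * x′ + y′ * y′ + z′ + k)
               ≡ (x - x′) * (x + x′) + (y - y′) * (y + y′) + (z - z′)
    factor = solve-∀
    difference : f - f′
                   ≡ (+ x - + x′) * (+ x + + x′) + (+ y - + y′) * (+ y + + y′) + (+ z - + z′)
    difference = trans (cong₂ _-_ (+form x y z k) (+form x′ y′ z′ k))
                       (factor (+ x) (+ y) (+ z) (+ x′) (+ y′) (+ z′) (+ k))
    d∣f-f′ : + d ∣ f - f′
    d∣f-f′ = subst (+ d ∣_) (sym difference) (∣m∣n⇒∣m+n (∣m∣n⇒∣m+n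
      (∣m⇒∣m*n (+ x + + x′) (restrict Dx)) (∣m⇒∣m*n (+ y + + y′) (restrict Dy))) (restrict Dz))

  linear-*ʳ : ∀ l m n u x y z → linear (l * u) (m * u) (n * u) x y z ≡ linear l m n x y z * u
  linear-*ʳ l m n u x y z = distribute l m n u (+ x) (+ y) (+ z)
    where
    distribute : ∀ l m n u x y z → l * u * x + m * u * y + n * u * z ≡ (l * x + m * y + n * z) * u
    distribute = solve-∀

  ∣linear-linear : ∀ {d x y z x′ y′ z′} l m n → d ∣ + x - + x′ → d ∣ + y - + y′ → d ∣ + z - + z′ →
                   d ∣ linear l m n x y z - linear l m n x′ y′ z′
  ∣linear-linear {d} {x} {y} {z} {x′} {y′} {z′} l m n dx dy dz =
    subst (d ∣_) (sym (factor l m n (+ x) (+ y) (+ z) (+ x′) (+ y′) (+ z′)))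
      (∣m∣n⇒∣m+n (∣m∣n⇒∣m+n (∣n⇒∣m*n l dx) (∣n⇒∣m*n m dy)) (∣n⇒∣m*n n dz))
    where
    factor : ∀ l m n x y z x′ y′ z′ →
             (l * x + m * y + n * z) - (l * x′ + m * y′ + n * z′)
               ≡ l * (x - x′) + m * (y - y′) + n * (z - z′)
    factor = solve-∀

module _ where
  open import Data.Fin using (Fin; toℕ; punchOut; combine)
  open import Data.Fin.Properties using (any?; _≟_; punchOut-injective; injective⇒≤; toℕ-fromℕ<; toℕ<n; toℕ-injective; combine-injective)
  open import Data.Fin.Permutation using (Permutation; permutation)
  open import Data.Nat.Properties using (<-irrefl)
  open import Data.Nat.DivMod using (_%_; _mod_; m%n<n)
  open import Relation.Nullary using (yes; no)
  open import Data.Empty using (⊥-elim)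
  open ≡ using (refl; sym; trans; cong)

  injective⇒surjective : ∀ {n} {f : Fin n → Fin n} → Injective _≡_ _≡_ f → ∀ y → ∃ λ x → f x ≡ y
  injective⇒surjective {zero}  {f} f-inj ()
  injective⇒surjective {suc n} {f} f-inj y with any? (λ x → f x ≟ y)
  ... | yes found = found
  ... | no  missed = ⊥-elim (<-irrefl refl (injective⇒≤ punchOut∘f-inj))
    where
    y≢f : ∀ x → y ≢ f x
    y≢f x y≡fx = missed (x , sym y≡fx)
    punchOut∘f-inj : Injective _≡_ _≡_ (λ x → punchOut (y≢f x))
    punchOut∘f-inj {x} {x′} eq = f-inj (punchOut-injective (y≢f x) (y≢f x′) eq)

  injective⇒permutation : ∀ {n} (f : Fin n → Fin n) → Injective _≡_ _≡_ f → Permutation n n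
  injective⇒permutation f f-inj = permutation f f⁻¹ (λ y → proj₂ (surj y)) (λ x → f-inj (proj₂ (surj (f x))))
    where
    surj : ∀ y → ∃ λ x → f x ≡ y
    surj = injective⇒surjective f-inj
    f⁻¹ : Fin _ → Fin _
    f⁻¹ y = proj₁ (surj y)

  toℕ-mod : ∀ m n .{{_ : NonZero n}} → toℕ (m mod n) ≡ m % n
  toℕ-mod m n = toℕ-fromℕ< (m%n<n m n)

  module _ (A B : ℕ) .{{_ : NonZero A}} .{{_ : NonZero B}} where

    crtMap : Fin (A ℕ.* B) → Fin (A ℕ.* B)
    crtMap i = combine (toℕ i mod A) (toℕ i mod B)

    crtPermutation : Coprime A B → Permutation (A ℕ.* B) (A ℕ.* B)
    crtPermutation A⊥B = injective⇒permutation crtMap crtMap-injective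
      where
      residue-eq : ∀ {i j} D .{{_ : NonZero D}} → toℕ i mod D ≡ toℕ j mod D → toℕ i % D ≡ toℕ j % D
      residue-eq {i} {j} D eq = trans (sym (toℕ-mod (toℕ i) D)) (trans (cong toℕ eq) (toℕ-mod (toℕ j) D))
      crtMap-injective : Injective _≡_ _≡_ crtMap
      crtMap-injective {i} {j} eq with combine-injective _ _ _ _ eq
      ... | eqA , eqB = toℕ-injective
        (crt-injective A B A⊥B (toℕ<n i) (toℕ<n j) (residue-eq A eqA) (residue-eq B eqB))

module FiniteSums {c ℓ : Level} (R : CommutativeRing c ℓ) where
  open CommutativeRing R
  open import Algebra.Properties.Semiring.Sum semiring
  open import Data.Fin as Fin using (Fin; toℕ; combine; remQuot; _↑ˡ_; _↑ʳ_)
  open import Data.Fin.Properties using (remQuot-combine)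
  open import Data.Fin.Permutation using (_⟨$⟩ʳ_)
  open import Data.Nat.DivMod using (_%_; _mod_)
  open import Data.List using (List; []; _∷_; map; applyUpTo; upTo)
  open import Relation.Binary.Reasoning.Setoid setoid
  open ≡ using (cong; cong₂)

  sumR-map : ∀ {A B : Set} (h : A → B) (xs : List A) (f : B → Carrier) → sumR R (map h xs) f ≡ sumR R xs (f ∘ h)
  sumR-map h []       f = ≡.refl
  sumR-map h (x ∷ xs) f = cong (_+_ (f (h x))) (sumR-map h xs f)

  sumR-applyUpTo : ∀ (g : ℕ → ℕ) n (f : ℕ → Carrier) → sumR R (applyUpTo g n) f ≡ ∑[ i < n ] f (g (toℕ i))
  sumR-applyUpTo g zero    f = ≡.refl
  sumR-applyUpTo g (suc n) f = cong (_+_ (f (g 0))) (sumR-applyUpTo (g ∘ suc) n f)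

  sumBelow : ℕ → (ℕ → Carrier) → Carrier
  sumBelow n f = ∑[ i < n ] f (toℕ i)

  sumBelow³ : ℕ → (ℕ → ℕ → ℕ → Carrier) → Carrier
  sumBelow³ n F = sumBelow n λ x → sumBelow n λ y → sumBelow n λ z → F x y z

  sumR³ : List ℕ → (ℕ → ℕ → ℕ → Carrier) → Carrier
  sumR³ xs F = sumR R xs λ x → sumR R xs λ y → sumR R xs λ z → F x y z

  sumBelow-cong : ∀ n {f g : ℕ → Carrier} → (∀ x → f x ≈ g x) → sumBelow n f ≈ sumBelow n g
  sumBelow-cong n f≈g = sum-cong-≋ {n} (λ i → f≈g (toℕ i))

  sumBelow³-cong : ∀ n {F G : ℕ → ℕ → ℕ → Carrier} → (∀ x y z → F x y z ≈ G x y z) →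
                   sumBelow³ n F ≈ sumBelow³ n G
  sumBelow³-cong n F≈G =
    sumBelow-cong n λ x → sumBelow-cong n λ y → sumBelow-cong n λ z → F≈G x y z

  sumR-range1 : ∀ n (f : ℕ → Carrier) → sumR R (range1 n) f ≡ sumBelow n (f ∘ suc)
  sumR-range1 n f = ≡.trans (sumR-map suc (upTo n) f) (sumR-applyUpTo id n (f ∘ suc))

  sumR³-range1 : ∀ n (F : ℕ → ℕ → ℕ → Carrier) →
                 sumR³ (range1 n) F ≈ sumBelow³ n (λ x y z → F (suc x) (suc y) (suc z))
  sumR³-range1 n F =
    trans (reflexive (sumR-range1 n λ x → sumR R (range1 n) λ y → sumR R (range1 n) λ z → F x y z))
      (sumBelow-cong n λ x → trans (reflexive (sumR-range1 n λ y → sumR R (range1 n) λ z → F (suc x) y z))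
        (sumBelow-cong n λ y → reflexive (sumR-range1 n λ z → F (suc x) (suc y) z)))

  ∑-↑ : ∀ m n (f : Fin (m ℕ.+ n) → Carrier) →
        ∑[ i < m ℕ.+ n ] f i ≈ ∑[ i < m ] f (i ↑ˡ n) + ∑[ j < n ] f (m ↑ʳ j)
  ∑-↑ zero    n f = sym (+-identityˡ _)
  ∑-↑ (suc m) n f = trans (+-congˡ (∑-↑ m n (f ∘ Fin.suc))) (sym (+-assoc _ _ _))

  ∑-combine : ∀ m n (f : Fin (m ℕ.* n) → Carrier) →
              ∑[ k < m ℕ.* n ] f k ≈ ∑[ i < m ] ∑[ j < n ] f (combine i j)
  ∑-combine zero    n f = refl
  ∑-combine (suc m) n f = trans (∑-↑ n (m ℕ.* n) f) (+-congˡ (∑-combine m n (f ∘ (n ↑ʳ_))))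

  module _ (A B : ℕ) .{{_ : NonZero A}} .{{_ : NonZero B}} (A⊥B : Coprime A B) where

    ∑-crt : (G : Fin A → Fin B → Carrier) →
            ∑[ k < A ℕ.* B ] G (toℕ k mod A) (toℕ k mod B) ≈ ∑[ i < A ] ∑[ j < B ] G i j
    ∑-crt G = begin
      ∑[ k < A ℕ.* B ] G (toℕ k mod A) (toℕ k mod B)
        ≈⟨ sum-cong-≋ {A ℕ.* B} (λ k → reflexive (cong (λ (i , j) → G i j) (remQuot-combine {A} {B} _ _))) ⟨
      ∑[ k < A ℕ.* B ] G′ (crtPermutation A B A⊥B ⟨$⟩ʳ k)
        ≈⟨ ∑-permute G′ (crtPermutation A B A⊥B) ⟨
      ∑[ k < A ℕ.* B ] G′ k
        ≈⟨ ∑-combine A B G′ ⟩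
      ∑[ i < A ] ∑[ j < B ] G′ (combine i j)
        ≈⟨ sum-cong-≋ {A} (λ i → sum-cong-≋ {B} (λ j → reflexive (cong (λ (i , j) → G i j) (remQuot-combine i j)))) ⟩
      ∑[ i < A ] ∑[ j < B ] G i j ∎
      where
      G′ : Fin (A ℕ.* B) → Carrier
      G′ k = let (i , j) = remQuot B k in G i j

    sumBelow-crt : (g : ℕ → ℕ → Carrier) →
                   sumBelow (A ℕ.* B) (λ k → g (k % A) (k % B)) ≈ sumBelow A λ i → sumBelow B λ j → g i j
    sumBelow-crt g = trans
      (sumBelow-cong (A ℕ.* B) λ k → reflexive (≡.sym (cong₂ g (toℕ-mod k A) (toℕ-mod k B))))
      (∑-crt λ i j → g (toℕ i) (toℕ j))

    sumBelow-crt-* : (f g : ℕ → Carrier) →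
                     sumBelow (A ℕ.* B) (λ k → f (k % A) * g (k % B)) ≈ sumBelow A f * sumBelow B g
    sumBelow-crt-* f g = begin
      sumBelow (A ℕ.* B) (λ k → f (k % A) * g (k % B)) ≈⟨ sumBelow-crt (λ i j → f i * g j) ⟩
      sumBelow A (λ i → sumBelow B λ j → f i * g j)    ≈⟨ sumBelow-cong A (λ i → *-distribˡ-sum {B} (f i) (λ j → g (toℕ j))) ⟨
      sumBelow A (λ i → f i * sumBelow B g)            ≈⟨ *-distribʳ-sum {A} (sumBelow B g) (λ i → f (toℕ i)) ⟨
      sumBelow A f * sumBelow B g                      ∎

    sumBelow³-crt-* : (F G : ℕ → ℕ → ℕ → Carrier) →
      sumBelow³ (A ℕ.* B) (λ x y z → F (x % A) (y % A) (z % A) * G (x % B) (y % B) (z % B))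
        ≈ sumBelow³ A F * sumBelow³ B G
    sumBelow³-crt-* F G = begin
      sumBelow³ (A ℕ.* B) (λ x y z → F (x % A) (y % A) (z % A) * G (x % B) (y % B) (z % B))
        ≈⟨ sumBelow-cong AB (λ x → sumBelow-cong AB λ y → sumBelow-crt-* (F (x % A) (y % A)) (G (x % B) (y % B))) ⟩
      sumBelow AB (λ x → sumBelow AB λ y → sumBelow A (F (x % A) (y % A)) * sumBelow B (G (x % B) (y % B)))
        ≈⟨ sumBelow-cong AB (λ x → sumBelow-crt-* (λ y → sumBelow A (F (x % A) y)) (λ y → sumBelow B (G (x % B) y))) ⟩
      sumBelow AB (λ x → sumBelow A (λ y → sumBelow A (F (x % A) y)) * sumBelow B (λ y → sumBelow B (G (x % B) y)))
        ≈⟨ sumBelow-crt-* (λ x → sumBelow A λ y → sumBelow A (F x y)) (λ x → sumBelow B λ y → sumBelow B (G x y)) ⟩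
      sumBelow³ A F * sumBelow³ B G ∎
      where
      AB : ℕ
      AB = A ℕ.* B

module _ where
  open import Data.Rational using (_/_; _+_)
  open import Data.Rational.Properties using (fromℚᵘ-cong; fromℚᵘ-toℚᵘ; toℚᵘ-fromℚᵘ; toℚᵘ-homo-+)
  open import Data.Rational.Unnormalised using (mkℚᵘ; *≡*)
  import Data.Rational.Unnormalised.Properties as ℚᵘₚ

  /-cross : ∀ i j D D′ .{{_ : NonZero D}} .{{_ : NonZero D′}} → i ℤ.* + D′ ≡ j ℤ.* + D → i / D ≡ j / D′
  /-cross i j (suc d) (suc d′) eq = fromℚᵘ-cong {mkℚᵘ i d} {mkℚᵘ j d′} (*≡* eq)

  /-+ : ∀ i j A B .{{_ : NonZero A}} .{{_ : NonZero B}} →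
        i / A + j / B ≡ _/_ (i ℤ.* + B ℤ.+ j ℤ.* + A) (A ℕ.* B) {{m*n≢0 A B}}
  /-+ i j (suc a) (suc b) = ≡.trans (≡.sym (fromℚᵘ-toℚᵘ _)) (fromℚᵘ-cong (ℚᵘₚ.≃-trans
    (toℚᵘ-homo-+ (i / suc a) (j / suc b))
    (ℚᵘₚ.+-cong (toℚᵘ-fromℚᵘ (mkℚᵘ i a)) (toℚᵘ-fromℚᵘ (mkℚᵘ j b)))))

module Character {c ℓ : Level} (R : CommutativeRing c ℓ) (e : ℚ → CommutativeRing.Carrier R)
                 (isExpChar : IsExpChar R e) where
  open CommutativeRing R
  open IsExpChar isExpChar
  open import Data.Rational as ℚ using (_/_; 0ℚ; 1ℚ)
  open import Data.Rational.Properties using (/-cong)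
  open import Data.Integer.Properties using (pos-*)
  open import Data.Integer.Divisibility.Signed using (_∣_; divides; ∣n⇒∣m*n)
  open import Data.Integer.Tactic.RingSolver using (solve-∀)
  open import Relation.Binary.Reasoning.Setoid setoid

  e-cong : ∀ {p q} → p ≡ q → e p ≈ e q
  e-cong = reflexive ∘ ≡.cong e

  e-+ : ∀ i j A B .{{_ : NonZero A}} .{{_ : NonZero B}} →
        e (i / A) * e (j / B) ≈ e (_/_ (i ℤ.* + B ℤ.+ j ℤ.* + A) (A ℕ.* B) {{m*n≢0 A B}})
  e-+ i j A B = trans (sym (e-hom (i / A) (j / B))) (e-cong (/-+ i j A B))

  e-zero : e 0ℚ ≈ 1#
  e-zero = begin
    e 0ℚ            ≈⟨ *-identityʳ (e 0ℚ) ⟨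
    e 0ℚ * 1#       ≈⟨ *-congˡ e-one ⟨
    e 0ℚ * e 1ℚ     ≈⟨ e-hom 0ℚ 1ℚ ⟨
    e (0ℚ ℚ.+ 1ℚ)   ≈⟨ e-one ⟩
    1#              ∎

  e-natural : ∀ n → e (+ n / 1) ≈ 1#
  e-natural zero    = e-zero
  e-natural (suc n) = begin
    e (+ suc n / 1)                       ≈⟨ e-cong (/-cong (x+1≡1+x (+ n)) ≡.refl) ⟨
    e ((+ n ℤ.* + 1 ℤ.+ + 1 ℤ.* + 1) / 1) ≈⟨ e-+ (+ n) (+ 1) 1 1 ⟨
    e (+ n / 1) * e (+ 1 / 1)             ≈⟨ *-cong (e-natural n) e-one ⟩
    1# * 1#                               ≈⟨ *-identityˡ 1# ⟩
    1#                                    ∎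
    where
    x+1≡1+x : ∀ x → x ℤ.* + 1 ℤ.+ + 1 ℤ.* + 1 ≡ + 1 ℤ.+ x
    x+1≡1+x = solve-∀

  e-integer : ∀ k → e (k / 1) ≈ 1#
  e-integer (+ n)          = e-natural n
  e-integer k@(ℤ.-[1+ n ]) = begin
    e (k / 1)                               ≈⟨ *-identityʳ (e (k / 1)) ⟨
    e (k / 1) * 1#                          ≈⟨ *-congˡ (e-natural (suc n)) ⟨
    e (k / 1) * e (+ suc n / 1)             ≈⟨ e-+ k (+ suc n) 1 1 ⟩
    e ((k ℤ.* + 1 ℤ.+ + suc n ℤ.* + 1) / 1) ≈⟨ e-cong (/-cong (-x+x≡0 (+ suc n)) ≡.refl) ⟩
    e (ℤ.0ℤ / 1)                            ≈⟨ e-zero ⟩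
    1#                                      ∎
    where
    -x+x≡0 : ∀ x → ℤ.- x ℤ.* + 1 ℤ.+ x ℤ.* + 1 ≡ ℤ.0ℤ
    -x+x≡0 = solve-∀

  e-periodic : ∀ i j D .{{_ : NonZero D}} → + D ∣ i ℤ.- j → e (i / D) ≈ e (j / D)
  e-periodic i j D (divides k i-j≡kD) = begin
    e (i / D)                                 ≈⟨ e-cong (/-cross i (j ℤ.* + 1 ℤ.+ k ℤ.* + D) D (D ℕ.* 1) i≡j+kD) ⟩
    e ((j ℤ.* + 1 ℤ.+ k ℤ.* + D) / (D ℕ.* 1)) ≈⟨ e-+ j k D 1 ⟨
    e (j / D) * e (k / 1)                     ≈⟨ *-congˡ (e-integer k) ⟩
    e (j / D) * 1#                            ≈⟨ *-identityʳ (e (j / D)) ⟩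
    e (j / D)                                 ∎
    where
    instance
      _ : NonZero (D ℕ.* 1)
      _ = m*n≢0 D 1
    regroup : ∀ i j d → i ℤ.* (d ℤ.* + 1) ≡ (j ℤ.* + 1 ℤ.+ (i ℤ.- j)) ℤ.* d
    regroup = solve-∀
    i≡j+kD : i ℤ.* + (D ℕ.* 1) ≡ (j ℤ.* + 1 ℤ.+ k ℤ.* + D) ℤ.* + D
    i≡j+kD = ≡.trans (≡.cong (i ℤ.*_) (pos-* D 1))
             (≡.trans (regroup i j (+ D)) (≡.cong (λ t → (j ℤ.* + 1 ℤ.+ t) ℤ.* + D) i-j≡kD))

  e-split : ∀ X u v A B .{{_ : NonZero A}} .{{_ : NonZero B}} →
            + (A ℕ.* B) ∣ u ℤ.* + B ℤ.+ v ℤ.* + A ℤ.- ℤ.1ℤ →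
            e (_/_ X (A ℕ.* B) {{m*n≢0 A B}}) ≈ e ((X ℤ.* u) / A) * e ((X ℤ.* v) / B)
  e-split X u v A B AB∣uB+vA-1 = sym (begin
    e ((X ℤ.* u) / A) * e ((X ℤ.* v) / B)
      ≈⟨ e-+ (X ℤ.* u) (X ℤ.* v) A B ⟩
    e (_/_ (X ℤ.* u ℤ.* + B ℤ.+ X ℤ.* v ℤ.* + A) (A ℕ.* B) {{m*n≢0 A B}})
      ≈⟨ e-periodic (X ℤ.* u ℤ.* + B ℤ.+ X ℤ.* v ℤ.* + A) X (A ℕ.* B) {{m*n≢0 A B}} AB∣difference ⟩
    e (_/_ X (A ℕ.* B) {{m*n≢0 A B}}) ∎)
    where
    factor : ∀ X u v a b → X ℤ.* (u ℤ.* b ℤ.+ v ℤ.* a ℤ.- ℤ.1ℤ) ≡ (X ℤ.* u ℤ.* b ℤ.+ X ℤ.* v ℤ.* a) ℤ.- X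
    factor = solve-∀
    AB∣difference : + (A ℕ.* B) ∣ (X ℤ.* u ℤ.* + B ℤ.+ X ℤ.* v ℤ.* + A) ℤ.- X
    AB∣difference = ≡.subst (+ (A ℕ.* B) ∣_) (factor X u v (+ A) (+ B)) (∣n⇒∣m*n X AB∣uB+vA-1)

module LamStarTerms {c ℓ : Level} (R : CommutativeRing c ℓ) (e : ℚ → CommutativeRing.Carrier R)
                    (isExpChar : IsExpChar R e) where
  open CommutativeRing R
  open FiniteSums R
  open Character R e isExpChar
  open import Data.Nat.Divisibility using (_∣?_; m∣m*n; n∣m*n) renaming (_∣_ to _∣ℕ_)
  open import Data.Integer.Divisibility.Signed using (_∣_)
  open import Data.Rational using (_/_)
  open import Data.Nat.DivMod using (_%_)
  open import Data.Rational.Properties using (/-cong)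
  open import Data.Product using (Σ)
  open import Data.Product.Function.NonDependent.Propositional using (_×-⇔_)
  open import Relation.Nullary using (Dec; yes; no)
  open import Relation.Nullary.Decidable using (_×-dec_)
  open import Data.Empty using (⊥-elim)
  import Data.Nat.Properties as ℕₚ
  open import Algebra.Properties.CommutativeSemigroup ℕₚ.*-commutativeSemigroup using (interchange)
  open Equivalence using (to; from)
  open import Relation.Binary.Reasoning.Setoid setoid

  when : {P : Set} → Dec P → Carrier → Carrier
  when (yes _) x = x
  when (no _)  _ = 0#

  when-cong : ∀ {P Q : Set} (P? : Dec P) (Q? : Dec Q) {x y} → P ⇔ Q → x ≈ y → when P? x ≈ when Q? y
  when-cong (yes _) (yes _)  _   x≈y = x≈y
  when-cong (yes p) (no ¬q)  P⇔Q _   = ⊥-elim (¬q (to P⇔Q p))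
  when-cong (no ¬p) (yes q)  P⇔Q _   = ⊥-elim (¬p (from P⇔Q q))
  when-cong (no _)  (no _)   _   _   = refl

  when-* : ∀ {P P₁ P₂ : Set} (P? : Dec P) (P₁? : Dec P₁) (P₂? : Dec P₂) {x x₁ x₂} →
           P ⇔ (P₁ × P₂) → x ≈ x₁ * x₂ → when P? x ≈ when P₁? x₁ * when P₂? x₂
  when-* (yes _) (yes _)  (yes _)  _  x≈ = x≈
  when-* (yes p) (no ¬p₁) _        P⇔ _  = ⊥-elim (¬p₁ (proj₁ (to P⇔ p)))
  when-* (yes p) (yes _)  (no ¬p₂) P⇔ _  = ⊥-elim (¬p₂ (proj₂ (to P⇔ p)))
  when-* (no ¬p) (yes p₁) (yes p₂) P⇔ _  = ⊥-elim (¬p (from P⇔ (p₁ , p₂)))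
  when-* (no _)  (yes _)  (no _)   _  _  = sym (zeroʳ _)
  when-* (no _)  (no _)   _        _  _  = sym (zeroˡ _)

  lamStarTerm : (q₁ q₂ : ℕ) .{{_ : NonZero q₁}} .{{_ : NonZero q₂}} (l m n : ℤ) → ℕ → ℕ → ℕ → Carrier
  lamStarTerm q₁ q₂ l m n x y z =
    when (q₁ ∣? form x y z 1 ×-dec q₂ ∣? form x y z 2)
         (e (_/_ (linear l m n x y z) (q₁ ℕ.* q₂) {{m*n≢0 q₁ q₂}}))

  lamStarTerm₀ : (q₁ q₂ : ℕ) .{{_ : NonZero q₁}} .{{_ : NonZero q₂}} (l m n : ℤ) → ℕ → ℕ → ℕ → Carrier
  lamStarTerm₀ q₁ q₂ l m n x y z = lamStarTerm q₁ q₂ l m n (suc x) (suc y) (suc z)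

  -- The summand of lamStar is local to its definition; packing it into a Σ lets unification name it.
  lamStar-summand : ∀ q₁ q₂ .{{_ : NonZero q₁}} .{{_ : NonZero q₂}} l m n →
                    Σ (ℕ → ℕ → ℕ → Carrier) λ T → lamStar R e q₁ q₂ l m n ≡ sumR³ (range1 (q₁ ℕ.* q₂)) T
  lamStar-summand q₁ q₂ l m n = _ , ≡.refl

  lamStar-summand≈lamStarTerm : ∀ q₁ q₂ .{{_ : NonZero q₁}} .{{_ : NonZero q₂}} l m n x y z →
    proj₁ (lamStar-summand q₁ q₂ l m n) x y z ≈ lamStarTerm q₁ q₂ l m n x y z
  lamStar-summand≈lamStarTerm q₁ q₂ l m n x y z with q₁ ∣? form x y z 1 | q₂ ∣? form x y z 2
  ... | yes _ | yes _ = refl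
  ... | yes _ | no _  = refl
  ... | no _  | _     = refl

  lamStar≈sumBelow³ : ∀ q₁ q₂ .{{_ : NonZero q₁}} .{{_ : NonZero q₂}} l m n →
    lamStar R e q₁ q₂ l m n
      ≈ sumBelow³ (q₁ ℕ.* q₂) (lamStarTerm₀ q₁ q₂ l m n)
  lamStar≈sumBelow³ q₁ q₂ l m n =
    trans (reflexive (proj₂ (lamStar-summand q₁ q₂ l m n)))
    (trans (sumR³-range1 (q₁ ℕ.* q₂) (proj₁ (lamStar-summand q₁ q₂ l m n)))
           (sumBelow³-cong (q₁ ℕ.* q₂) λ x y z → lamStar-summand≈lamStarTerm q₁ q₂ l m n (suc x) (suc y) (suc z)))

  lamStarTerm-cong : ∀ q₁ q₂ .{{_ : NonZero q₁}} .{{_ : NonZero q₂}} l m n {x y z x′ y′ z′} →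
    let Q = q₁ ℕ.* q₂ in + Q ∣ + x ℤ.- + x′ → + Q ∣ + y ℤ.- + y′ → + Q ∣ + z ℤ.- + z′ →
    lamStarTerm q₁ q₂ l m n x y z ≈ lamStarTerm q₁ q₂ l m n x′ y′ z′
  lamStarTerm-cong q₁ q₂ l m n {x} {y} {z} {x′} {y′} {z′} Qx Qy Qz =
    when-cong (q₁ ∣? form x y z 1 ×-dec q₂ ∣? form x y z 2) (q₁ ∣? form x′ y′ z′ 1 ×-dec q₂ ∣? form x′ y′ z′ 2)
      (∣form⇔∣form′ 1 (m∣m*n {q₁} q₂) ×-⇔ ∣form⇔∣form′ 2 (n∣m*n q₁ {q₂}))
      (e-periodic (linear l m n x y z) (linear l m n x′ y′ z′) (q₁ ℕ.* q₂) {{m*n≢0 q₁ q₂}}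
        (∣linear-linear {x = x} {y} {z} {x′} {y′} {z′} l m n Qx Qy Qz))
    where
    ∣form⇔∣form′ : ∀ {d} k → d ∣ℕ q₁ ℕ.* q₂ → d ∣ℕ form x y z k ⇔ d ∣ℕ form x′ y′ z′ k
    ∣form⇔∣form′ k d∣Q =
      ∣form⇔∣form {x = x} {y} {z} {x′} {y′} {z′} k d∣Q Qx Qy Qz

  module _ (q₁ q₂ q₃ q₄ : ℕ) .{{_ : NonZero q₁}} .{{_ : NonZero q₂}} .{{_ : NonZero q₃}} .{{_ : NonZero q₄}}
           (q₁⊥q₂ : Coprime q₁ q₂) (q₃⊥q₄ : Coprime q₃ q₄) (l m n u v : ℤ) where
    private
      A B : ℕ
      A = q₁ ℕ.* q₃
      B = q₂ ℕ.* q₄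
      instance
        _ : NonZero (q₁ ℕ.* q₂)
        _ = m*n≢0 q₁ q₂
        _ : NonZero (q₃ ℕ.* q₄)
        _ = m*n≢0 q₃ q₄
        _ : NonZero A
        _ = m*n≢0 q₁ q₃
        _ : NonZero B
        _ = m*n≢0 q₂ q₄
        _ : NonZero ((q₁ ℕ.* q₂) ℕ.* (q₃ ℕ.* q₄))
        _ = m*n≢0 (q₁ ℕ.* q₂) (q₃ ℕ.* q₄)
        _ : NonZero (A ℕ.* B)
        _ = m*n≢0 A B

    lamStarTerm-split : + (A ℕ.* B) ∣ u ℤ.* + B ℤ.+ v ℤ.* + A ℤ.- ℤ.1ℤ → ∀ x y z →
      lamStarTerm (q₁ ℕ.* q₂) (q₃ ℕ.* q₄) l m n x y z
        ≈ lamStarTerm q₁ q₃ (l ℤ.* u) (m ℤ.* u) (n ℤ.* u) x y z * lamStarTerm q₂ q₄ (l ℤ.* v) (m ℤ.* v) (n ℤ.* v) x y z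
    lamStarTerm-split AB∣uB+vA-1 x y z =
      when-* (q₁ ℕ.* q₂ ∣? F₁ ×-dec q₃ ℕ.* q₄ ∣? F₂) (q₁ ∣? F₁ ×-dec q₃ ∣? F₂) (q₂ ∣? F₁ ×-dec q₄ ∣? F₂)
        divisibility character
      where
      F₁ F₂ : ℕ
      F₁ = form x y z 1
      F₂ = form x y z 2
      X : ℤ
      X = linear l m n x y z
      divisibility : (q₁ ℕ.* q₂ ∣ℕ F₁ × q₃ ℕ.* q₄ ∣ℕ F₂) ⇔ ((q₁ ∣ℕ F₁ × q₃ ∣ℕ F₂) × (q₂ ∣ℕ F₁ × q₄ ∣ℕ F₂))
      divisibility = mk⇔
        (λ (q₁q₂∣F₁ , q₃q₄∣F₂) →
          let (q₁∣F₁ , q₂∣F₁) = to (coprime⇒*∣⇔ q₁⊥q₂) q₁q₂∣F₁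
              (q₃∣F₂ , q₄∣F₂) = to (coprime⇒*∣⇔ q₃⊥q₄) q₃q₄∣F₂
          in (q₁∣F₁ , q₃∣F₂) , (q₂∣F₁ , q₄∣F₂))
        (λ ((q₁∣F₁ , q₃∣F₂) , (q₂∣F₁ , q₄∣F₂)) →
          from (coprime⇒*∣⇔ q₁⊥q₂) (q₁∣F₁ , q₂∣F₁) , from (coprime⇒*∣⇔ q₃⊥q₄) (q₃∣F₂ , q₄∣F₂))
      character : e (X / ((q₁ ℕ.* q₂) ℕ.* (q₃ ℕ.* q₄)))
                    ≈ e (linear (l ℤ.* u) (m ℤ.* u) (n ℤ.* u) x y z / A) * e (linear (l ℤ.* v) (m ℤ.* v) (n ℤ.* v) x y z / B)
      character = begin
        e (X / ((q₁ ℕ.* q₂) ℕ.* (q₃ ℕ.* q₄)))   ≡⟨ ≡.cong e (/-cong {X} ≡.refl (interchange q₁ q₂ q₃ q₄)) ⟩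
        e (X / (A ℕ.* B))                       ≈⟨ e-split X u v A B AB∣uB+vA-1 ⟩
        e ((X ℤ.* u) / A) * e ((X ℤ.* v) / B)   ≡⟨ ≡.cong₂ (λ s t → e (s / A) * e (t / B)) (linear-*ʳ l m n u x y z) (linear-*ʳ l m n v x y z) ⟨
        e (linear (l ℤ.* u) (m ℤ.* u) (n ℤ.* u) x y z / A) * e (linear (l ℤ.* v) (m ℤ.* v) (n ℤ.* v) x y z / B) ∎

    lamStarTerm₀-crt : + (A ℕ.* B) ∣ u ℤ.* + B ℤ.+ v ℤ.* + A ℤ.- ℤ.1ℤ → ∀ x y z →
      lamStarTerm₀ (q₁ ℕ.* q₂) (q₃ ℕ.* q₄) l m n x y z
        ≈ lamStarTerm₀ q₁ q₃ (l ℤ.* u) (m ℤ.* u) (n ℤ.* u) (x % A) (y % A) (z % A)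
          * lamStarTerm₀ q₂ q₄ (l ℤ.* v) (m ℤ.* v) (n ℤ.* v) (x % B) (y % B) (z % B)
    lamStarTerm₀-crt AB∣uB+vA-1 x y z = trans (lamStarTerm-split AB∣uB+vA-1 (suc x) (suc y) (suc z))
      (*-cong (lamStarTerm-cong q₁ q₃ (l ℤ.* u) (m ℤ.* u) (n ℤ.* u)
                 (n∣[1+m]-[1+m%n] x A) (n∣[1+m]-[1+m%n] y A) (n∣[1+m]-[1+m%n] z A))
              (lamStarTerm-cong q₂ q₄ (l ℤ.* v) (m ℤ.* v) (n ℤ.* v)
                 (n∣[1+m]-[1+m%n] x B) (n∣[1+m]-[1+m%n] y B) (n∣[1+m]-[1+m%n] z B)))

mainTheorem5 : ∀ {c ℓ : Level} (R : CommutativeRing c ℓ) (e : ℚ → CommutativeRing.Carrier R) →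
    IsExpChar R e →
    (q₁ q₂ q₃ q₄ : ℕ) .{{_ : NonZero q₁}} .{{_ : NonZero q₂}} .{{_ : NonZero q₃}} .{{_ : NonZero q₄}} →
    gcd (q₁ ℕ.* q₂) (q₃ ℕ.* q₄) ≡ 1 → gcd q₁ q₂ ≡ 1 → gcd q₃ q₄ ≡ 1 →
    (l m n : ℤ) →
    (u v : ℤ) →
    IsInverseMod u (+ (q₂ ℕ.* q₄)) (q₁ ℕ.* q₃) →
    IsInverseMod v (+ (q₁ ℕ.* q₃)) (q₂ ℕ.* q₄) →
    CommutativeRing._≈_ R
      (lamStar R e (q₁ ℕ.* q₂) (q₃ ℕ.* q₄) {{m*n≢0 q₁ q₂}} {{m*n≢0 q₃ q₄}} l m n)
      (CommutativeRing._*_ R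
        (lamStar R e q₁ q₃ (l ℤ.* u) (m ℤ.* u) (n ℤ.* u))
        (lamStar R e q₂ q₄ (l ℤ.* v) (m ℤ.* v) (n ℤ.* v)))
mainTheorem5 R e isExpChar q₁ q₂ q₃ q₄ gcd≡1 gcd₁₂≡1 gcd₃₄≡1 l m n u v u⁻¹ v⁻¹ = begin
  lamStar R e (q₁ ℕ.* q₂) (q₃ ℕ.* q₄) l m n
    ≈⟨ lamStar≈sumBelow³ (q₁ ℕ.* q₂) (q₃ ℕ.* q₄) l m n ⟩
  sumBelow³ N (lamStarTerm₀ (q₁ ℕ.* q₂) (q₃ ℕ.* q₄) l m n)
    ≈⟨ sumBelow³-cong N (lamStarTerm₀-crt q₁ q₂ q₃ q₄ q₁⊥q₂ q₃⊥q₄ l m n u v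
                          (inverseMod-crt {A} {B} {u} {v} A⊥B u⁻¹ v⁻¹)) ⟩
  sumBelow³ N T
    ≡⟨ ≡.cong (λ K → sumBelow³ K T) (interchange q₁ q₂ q₃ q₄) ⟩
  sumBelow³ (A ℕ.* B) T
    ≈⟨ sumBelow³-crt-* A B A⊥B T₁ T₂ ⟩
  sumBelow³ A T₁ * sumBelow³ B T₂
    ≈⟨ *-cong (lamStar≈sumBelow³ q₁ q₃ (l ℤ.* u) (m ℤ.* u) (n ℤ.* u))
              (lamStar≈sumBelow³ q₂ q₄ (l ℤ.* v) (m ℤ.* v) (n ℤ.* v)) ⟨
  lamStar R e q₁ q₃ (l ℤ.* u) (m ℤ.* u) (n ℤ.* u) * lamStar R e q₂ q₄ (l ℤ.* v) (m ℤ.* v) (n ℤ.* v) ∎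
  where
  open CommutativeRing R
  open FiniteSums R
  open LamStarTerms R e isExpChar
  open import Relation.Binary.Reasoning.Setoid setoid
  open import Data.Nat.DivMod using (_%_)
  import Data.Nat.Properties as ℕₚ
  open import Algebra.Properties.CommutativeSemigroup ℕₚ.*-commutativeSemigroup using (interchange)
  A B N : ℕ
  A = q₁ ℕ.* q₃
  B = q₂ ℕ.* q₄
  N = (q₁ ℕ.* q₂) ℕ.* (q₃ ℕ.* q₄)
  instance
    _ : NonZero (q₁ ℕ.* q₂)
    _ = m*n≢0 q₁ q₂
    _ : NonZero (q₃ ℕ.* q₄)
    _ = m*n≢0 q₃ q₄
    _ : NonZero A
    _ = m*n≢0 q₁ q₃
    _ : NonZero B
    _ = m*n≢0 q₂ q₄
  q₁⊥q₂ : Coprime q₁ q₂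
  q₁⊥q₂ = Coprime.gcd≡1⇒coprime gcd₁₂≡1
  q₃⊥q₄ : Coprime q₃ q₄
  q₃⊥q₄ = Coprime.gcd≡1⇒coprime gcd₃₄≡1
  A⊥B : Coprime A B
  A⊥B = coprime-interchange q₁⊥q₂ q₃⊥q₄ (Coprime.gcd≡1⇒coprime gcd≡1)
  T₁ T₂ T : ℕ → ℕ → ℕ → Carrier
  T₁ = lamStarTerm₀ q₁ q₃ (l ℤ.* u) (m ℤ.* u) (n ℤ.* u)
  T₂ = lamStarTerm₀ q₂ q₄ (l ℤ.* v) (m ℤ.* v) (n ℤ.* v)
  T x y z = T₁ (x % A) (y % A) (z % A) * T₂ (x % B) (y % B) (z % B)
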